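{- Let $G$ be a graph and fix a vertex $P\in V(G)$. Then $H_f(P)$ is an additive submonoid of $\mathbb{N}$. Further, if $G$ is simple, then $H_f(P)$ is a numerical semigroup.
   Context: A graph is a finite connected multigraph with no loop edges; a simple graph is a graph with no multiple edges and more than one vertex. $\mathbb{N}=\{0,1,2,\dots\}$. A numerical semigroup is an additive submonoid of $\mathbb{N}$ with finite complement. Let $\mathcal{M}(G)$ be the set of functions $V(G)\to\mathbb{Z}$; for $f\in\mathcal{M}(G)$, $\Delta f(Q)=\sum_{e=QR\in E(G)}(f(Q)-f(R))$ (edges counted with multiplicity). $H_f(P)=\{n\in\mathbb{N}:\exists f\in\mathcal{M}(G)\text{ with }\Delta f(P)=-n\text{ and }\Delta f(Q)\ge 0\ \forall Q\neq P\}$. -}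

module Defs where

open import Data.Nat using (ℕ; _≤_)
open import Data.Fin using (Fin; _≟_)
open import Data.Integer as ℤ using (ℤ; +_; -_; 0ℤ)
open import Data.List using (List; []; _∷_)
open import Data.List.Relation.Unary.All using (All)
open import Data.List.Relation.Unary.AllPairs using (AllPairs)
open import Data.Product using (Σ; _×_; _,_; proj₁; proj₂; ∃)
open import Data.Sum using (_⊎_)
open import Relation.Nullary using (¬_; does)
open import Relation.Binary.PropositionalEquality using (_≡_; _≢_)
open import Relation.Binary.Construct.Closure.ReflexiveTransitive using (Star)
open import Data.Bool using (if_then_else_)
open import Data.List.Membership.Propositional using (_∈_)

-- An edge is an (unordered) pair of vertices, recorded as an ordered pair;
-- a multigraph is a list of edges (repetitions = multiplicities).
Edge : ℕ → Set
Edge n = Fin n × Fin n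

Adjacent : {n : ℕ} → List (Edge n) → Fin n → Fin n → Set
Adjacent es u v = ((u , v) ∈ es) ⊎ ((v , u) ∈ es)

record Graph : Set where
  field
    n         : ℕ
    edges     : List (Edge n)
    noLoops   : All (λ e → proj₁ e ≢ proj₂ e) edges
    connected : (u v : Fin n) → Star (Adjacent edges) u v
open Graph public

SameEdge : {n : ℕ} → Edge n → Edge n → Set
SameEdge (a , b) (c , d) = ((a ≡ c) × (b ≡ d)) ⊎ ((a ≡ d) × (b ≡ c))

IsSimple : Graph → Set
IsSimple G = AllPairs (λ e e' → ¬ SameEdge e e') (edges G) × (2 ≤ n G)

M : Graph → Set
M G = Fin (n G) → ℤ

edgeContrib : {k : ℕ} → (Fin k → ℤ) → Fin k → Edge k → ℤ
edgeContrib f Q (a , b) =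
  if does (a ≟ Q) then f a ℤ.- f b
  else (if does (b ≟ Q) then f b ℤ.- f a else 0ℤ)

sumContrib : {k : ℕ} → (Fin k → ℤ) → Fin k → List (Edge k) → ℤ
sumContrib f Q []       = 0ℤ
sumContrib f Q (e ∷ es) = edgeContrib f Q e ℤ.+ sumContrib f Q es

Δ : (G : Graph) → M G → Fin (n G) → ℤ
Δ G f Q = sumContrib f Q (edges G)

InH : (G : Graph) → Fin (n G) → ℕ → Set
InH G P k = Σ (M G) λ f →
  (Δ G f P ≡ - (+ k)) × ((Q : Fin (n G)) → Q ≢ P → 0ℤ ℤ.≤ Δ G f Q)

IsSubmonoid : (ℕ → Set) → Set
IsSubmonoid S = S 0 × ((a b : ℕ) → S a → S b → S (a Data.Nat.+ b))

IsNumericalSemigroup : (ℕ → Set) → Set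
IsNumericalSemigroup S = IsSubmonoid S × ∃ λ N → (k : ℕ) → N ≤ k → S k

-- H_f(P) is closed under addition because Δ is linear. Call f admissible if
-- Δf ≥ 0 away from P; since the values of Δf sum to zero over the vertices,
-- Δf(P) ≤ 0 for such f, so for a simple graph it suffices to find admissible
-- f and h with Δh(P) = Δf(P) + 1: two consecutive elements of a submonoid of ℕ
-- force a finite complement. With E the number of edges, along any edge X — R
-- the function E·g − (X) is admissible and positive at R whenever g is
-- admissible and positive at X; walking from P to every vertex and summing
-- gives an admissible Φ with ΔΦ ≥ 1 away from P. For a neighbour Y of P take
-- f = E·Φ and h = E·Φ − (Y): then Δh(P) − Δf(P) is the number of edges PY,
-- which is 1 in a simple graph.
module Submission where

open import Defs
open import Data.Fin using (Fin; zero; suc; _≟_; punchIn)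
open import Data.Fin.Properties using (punchInᵢ≢i)
open import Data.Product using (_×_; _,_; proj₁; proj₂; Σ; ∃)
open import Data.Sum using (inj₁; inj₂; swap)
open import Data.Bool using (if_then_else_; true; false)
open import Data.Nat as ℕ using (ℕ; zero; suc; s≤s)
import Data.Nat.Properties as ℕP
open import Data.Nat.DivMod using (_/_; _%_; m≡m%n+[m/n]*n; m%n<n; m*n/n≡m; /-monoˡ-≤)
import Data.Nat.Tactic.RingSolver as ℕ-Solver
open import Data.Integer as ℤ using (ℤ; +_; -_; 0ℤ; 1ℤ; -1ℤ; _+_; _*_; _-_; _≤_; -≤+; -[1+_]; +≤+)
import Data.Integer.Properties as ℤP
open import Algebra.Properties.CommutativeSemigroup ℤP.+-commutativeSemigroup using (interchange)
open import Algebra.Properties.CommutativeMonoid.Sum ℤP.+-0-commutativeMonoid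
  using (sum; sum-remove; ∑-distrib-+; sum-cong-≗; sum-replicate-zero)
open import Data.List using (List; []; _∷_; length)
open import Data.List.Relation.Unary.All as All using (All; []; _∷_)
open import Data.List.Relation.Unary.Any as Any using (Any; here; there)
open import Data.List.Relation.Unary.AllPairs using (AllPairs; []; _∷_)
open import Relation.Nullary using (¬_; Dec; does; yes; no; contradiction)
open import Relation.Nullary.Decidable using (dec-true; dec-false)
open import Relation.Binary.PropositionalEquality
open import Relation.Binary.Construct.Closure.ReflexiveTransitive using (Star; ε; _◅_)

private
  variable
    k : ℕ
    es : List (Edge k)
    Q X : Fin k

_⊕_ : (Fin k → ℤ) → (Fin k → ℤ) → Fin k → ℤ
(f ⊕ g) Q = f Q + g Q

_⊙_ : ℤ → (Fin k → ℤ) → Fin k → ℤ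
(c ⊙ f) Q = c * f Q

infixl 6 _⊕_
infixl 7 _⊙_

point : Fin k → ℤ → Fin k → ℤ
point a x Q = if does (a ≟ Q) then x else 0ℤ

point-here : (a : Fin k) (x : ℤ) → point a x a ≡ x
point-here a x rewrite dec-true (a ≟ a) refl = refl

point-off : ∀ {a} (x : ℤ) → a ≢ Q → point a x Q ≡ 0ℤ
point-off {Q = Q} {a} x a≢Q rewrite dec-false (a ≟ Q) a≢Q = refl

point-nonpos : (X Y : Fin k) → point X -1ℤ Y ≤ 0ℤ
point-nonpos X Y with does (X ≟ Y)
... | true  = -≤+
... | false = ℤP.≤-refl

+-minus-interchange : ∀ a b c d → (a + b) - (c + d) ≡ (a - c) + (b - d)
+-minus-interchange a b c d = begin
  (a + b) - (c + d)     ≡⟨ cong (λ z → (a + b) + z) (ℤP.neg-distrib-+ c d) ⟩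
  (a + b) + (- c + - d) ≡⟨ interchange a b (- c) (- d) ⟩
  (a - c) + (b - d)     ∎
  where open ≡-Reasoning

*-distribˡ-minus : ∀ c a b → c * (a - b) ≡ c * a - c * b
*-distribˡ-minus c a b =
  trans (ℤP.*-distribˡ-+ c a (- b)) (cong (λ z → c * a + z) (sym (ℤP.neg-distribʳ-* c b)))

*-nonNeg : ∀ m {x} → 0ℤ ≤ x → 0ℤ ≤ + m * x
*-nonNeg m {x} 0≤x = subst (_≤ + m * x) (ℤP.*-zeroʳ (+ m)) (ℤP.*-monoˡ-≤-nonNeg (+ m) 0≤x)

≤-minus-nonPos : ∀ i {j} → j ≤ 0ℤ → i ≤ i - j
≤-minus-nonPos i j≤0 =
  subst (_≤ i - _) (ℤP.+-identityʳ i) (ℤP.+-monoʳ-≤ i (ℤP.neg-mono-≤ j≤0))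

nonPos⇒neg : ∀ z → z ≤ 0ℤ → ∃ λ a → z ≡ - (+ a)
nonPos⇒neg (+ zero)  _ = 0 , refl
nonPos⇒neg -[1+ m ]  _ = suc m , refl
nonPos⇒neg (+ suc m) (+≤+ ())

neg-minus-one : ∀ a → - (+ a) - 1ℤ ≡ - (+ suc a)
neg-minus-one zero    = refl
neg-minus-one (suc a) = cong -[1+_] (cong suc (ℕP.+-identityʳ a))

∑-nonneg : (h : Fin k → ℤ) → (∀ i → 0ℤ ≤ h i) → 0ℤ ≤ sum h
∑-nonneg {zero}  h _   = ℤP.≤-refl
∑-nonneg {suc k} h h≥0 = ℤP.+-mono-≤ (h≥0 zero) (∑-nonneg (λ i → h (suc i)) (λ i → h≥0 (suc i)))

∑-≥-term : (a : Fin k) (h : Fin k → ℤ) → (∀ i → i ≢ a → 0ℤ ≤ h i) → h a ≤ sum h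
∑-≥-term {suc k} a h rest≥0 = begin
  h a                           ≡⟨ ℤP.+-identityʳ (h a) ⟨
  h a + 0ℤ                      ≤⟨ ℤP.+-monoʳ-≤ (h a) (∑-nonneg _ (λ i → rest≥0 _ (punchInᵢ≢i a i))) ⟩
  h a + sum (λ i → h (punchIn a i)) ≡⟨ sum-remove {i = a} h ⟨
  sum h                         ∎
  where open ℤP.≤-Reasoning

∑-point : (a : Fin k) (x : ℤ) → sum (point a x) ≡ x
∑-point {suc k} a x = begin
  sum (point a x)                                   ≡⟨ sum-remove {i = a} (point a x) ⟩
  point a x a + sum (λ i → point a x (punchIn a i)) ≡⟨ cong₂ _+_ (point-here a x) rest≡0 ⟩
  x + 0ℤ                                            ≡⟨ ℤP.+-identityʳ x ⟩
  x                                                 ∎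
  where
  open ≡-Reasoning
  rest≡0 : sum (λ i → point a x (punchIn a i)) ≡ 0ℤ
  rest≡0 = trans (sum-cong-≗ (λ i → point-off x (≢-sym (punchInᵢ≢i a i)))) (sum-replicate-zero k)

sumContrib-⊕ : ∀ (f g : Fin k → ℤ) Q es → sumContrib (f ⊕ g) Q es ≡ sumContrib f Q es + sumContrib g Q es
sumContrib-⊕ f g Q []             = refl
sumContrib-⊕ f g Q ((a , b) ∷ es) =
  trans (cong₂ _+_ edge (sumContrib-⊕ f g Q es))
    (interchange (edgeContrib f Q (a , b)) (edgeContrib g Q (a , b)) (sumContrib f Q es) (sumContrib g Q es))
  where
  edge : edgeContrib (f ⊕ g) Q (a , b) ≡ edgeContrib f Q (a , b) + edgeContrib g Q (a , b)
  edge with does (a ≟ Q) | does (b ≟ Q)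
  ... | true  | _     = +-minus-interchange (f a) (g a) (f b) (g b)
  ... | false | true  = +-minus-interchange (f b) (g b) (f a) (g a)
  ... | false | false = refl

sumContrib-⊙ : ∀ c (f : Fin k → ℤ) Q es → sumContrib (c ⊙ f) Q es ≡ c * sumContrib f Q es
sumContrib-⊙ c f Q []             = sym (ℤP.*-zeroʳ c)
sumContrib-⊙ c f Q ((a , b) ∷ es) =
  trans (cong₂ _+_ edge (sumContrib-⊙ c f Q es)) (sym (ℤP.*-distribˡ-+ c _ _))
  where
  edge : edgeContrib (c ⊙ f) Q (a , b) ≡ c * edgeContrib f Q (a , b)
  edge with does (a ≟ Q) | does (b ≟ Q)
  ... | true  | _     = sym (*-distribˡ-minus c (f a) (f b))
  ... | false | true  = sym (*-distribˡ-minus c (f b) (f a))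
  ... | false | false = sym (ℤP.*-zeroʳ c)

sumContrib-0 : ∀ (Q : Fin k) es → sumContrib (λ _ → 0ℤ) Q es ≡ 0ℤ
sumContrib-0 Q es = sumContrib-⊙ 0ℤ (λ _ → 0ℤ) Q es

sumContrib-∑ : ∀ {m} (h : Fin m → Fin k → ℤ) Q es →
  sumContrib (λ Y → sum (λ R → h R Y)) Q es ≡ sum (λ R → sumContrib (h R) Q es)
sumContrib-∑ {m = zero}  h Q es = sumContrib-0 Q es
sumContrib-∑ {m = suc m} h Q es =
  trans (sumContrib-⊕ (h zero) _ Q es) (cong (λ z → sumContrib (h zero) Q es + z) (sumContrib-∑ (λ R → h (suc R)) Q es))

edgeContrib-split : ∀ (f : Fin k → ℤ) {a b} → a ≢ b → ∀ Q →
  edgeContrib f Q (a , b) ≡ (point a (f a - f b) ⊕ point b (f b - f a)) Q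
edgeContrib-split f {a} {b} a≢b Q with a ≟ Q | b ≟ Q
... | yes refl | yes refl = contradiction refl a≢b
... | yes refl | no _     = sym (ℤP.+-identityʳ _)
... | no _     | yes refl = sym (ℤP.+-identityˡ _)
... | no _     | no _     = refl

∑-sumContrib : (f : Fin k → ℤ) (es : List (Edge k)) →
  All (λ e → proj₁ e ≢ proj₂ e) es → sum (λ Q → sumContrib f Q es) ≡ 0ℤ
∑-sumContrib {k} f []       _                = sum-replicate-zero k
∑-sumContrib f ((a , b) ∷ es) (a≢b ∷ loopless) = begin
  sum (λ Q → edgeContrib f Q (a , b) + sumContrib f Q es)
    ≡⟨ ∑-distrib-+ (λ Q → edgeContrib f Q (a , b)) _ ⟩
  sum (λ Q → edgeContrib f Q (a , b)) + sum (λ Q → sumContrib f Q es)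
    ≡⟨ cong₂ _+_ edge (∑-sumContrib f es loopless) ⟩
  0ℤ + 0ℤ
    ∎
  where
  open ≡-Reasoning
  edge : sum (λ Q → edgeContrib f Q (a , b)) ≡ 0ℤ
  edge = begin
    sum (λ Q → edgeContrib f Q (a , b))                     ≡⟨ sum-cong-≗ (edgeContrib-split f a≢b) ⟩
    sum (point a (f a - f b) ⊕ point b (f b - f a))         ≡⟨ ∑-distrib-+ (point a _) (point b _) ⟩
    sum (point a (f a - f b)) + sum (point b (f b - f a))   ≡⟨ cong₂ _+_ (∑-point a _) (∑-point b _) ⟩
    (f a - f b) + (f b - f a)                               ≡⟨ ℤP.+-minus-telescope (f a) (f b) (f a) ⟩
    f a - f a                                               ≡⟨ ℤP.+-inverseʳ (f a) ⟩
    0ℤ                                                      ∎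

edgeContrib-≥ : ∀ (f : Fin k → ℤ) → (∀ R → f R ≤ 0ℤ) → ∀ Q e → f Q ≤ edgeContrib f Q e
edgeContrib-≥ f f≤0 Q (a , b) with a ≟ Q | b ≟ Q
... | yes refl | _        = ≤-minus-nonPos (f a) (f≤0 b)
... | no _     | yes refl = ≤-minus-nonPos (f b) (f≤0 a)
... | no _     | no _     = f≤0 Q

sumContrib-≥ : ∀ (f : Fin k → ℤ) → (∀ R → f R ≤ 0ℤ) → ∀ Q es → + length es * f Q ≤ sumContrib f Q es
sumContrib-≥ f f≤0 Q []       = ℤP.≤-refl
sumContrib-≥ f f≤0 Q (e ∷ es) =
  subst (_≤ sumContrib f Q (e ∷ es)) (sym (ℤP.suc-* (+ length es) (f Q)))
    (ℤP.+-mono-≤ (edgeContrib-≥ f f≤0 Q e) (sumContrib-≥ f f≤0 Q es))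

Joins : Fin k → Fin k → Edge k → Set
Joins Q X e = SameEdge e (Q , X)

edgeContrib-source : ∀ (f : Fin k → ℤ) a b → edgeContrib f a (a , b) ≡ f a - f b
edgeContrib-source f a b rewrite dec-true (a ≟ a) refl = refl

edgeContrib-target : ∀ (f : Fin k → ℤ) {a b} → a ≢ b → edgeContrib f b (a , b) ≡ f b - f a
edgeContrib-target f {a} {b} a≢b rewrite dec-false (a ≟ b) a≢b | dec-true (b ≟ b) refl = refl

edgeContrib-joining : ∀ e → Q ≢ X → Joins Q X e → edgeContrib (point X -1ℤ) Q e ≡ 1ℤ
edgeContrib-joining {Q = Q} {X} (_ , _) Q≢X (inj₁ (refl , refl)) = begin
  edgeContrib (point X -1ℤ) Q (Q , X) ≡⟨ edgeContrib-source (point X -1ℤ) Q X ⟩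
  point X -1ℤ Q - point X -1ℤ X       ≡⟨ cong₂ _-_ (point-off -1ℤ (≢-sym Q≢X)) (point-here X -1ℤ) ⟩
  0ℤ - -1ℤ                            ∎
  where open ≡-Reasoning
edgeContrib-joining {Q = Q} {X} (_ , _) Q≢X (inj₂ (refl , refl)) = begin
  edgeContrib (point X -1ℤ) Q (X , Q) ≡⟨ edgeContrib-target (point X -1ℤ) (≢-sym Q≢X) ⟩
  point X -1ℤ Q - point X -1ℤ X       ≡⟨ cong₂ _-_ (point-off -1ℤ (≢-sym Q≢X)) (point-here X -1ℤ) ⟩
  0ℤ - -1ℤ                            ∎
  where open ≡-Reasoning

edgeContrib-notJoining : ∀ e → Q ≢ X → ¬ Joins Q X e → edgeContrib (point X -1ℤ) Q e ≡ 0ℤ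
edgeContrib-notJoining {Q = Q} {X} (a , b) Q≢X ¬joins with a ≟ Q | b ≟ Q
... | yes refl | _        =
  cong₂ _-_ (point-off -1ℤ (≢-sym Q≢X)) (point-off -1ℤ (λ X≡b → ¬joins (inj₁ (refl , sym X≡b))))
... | no _     | yes refl =
  cong₂ _-_ (point-off -1ℤ (≢-sym Q≢X)) (point-off -1ℤ (λ X≡a → ¬joins (inj₂ (sym X≡a , refl))))
... | no _     | no _     = refl

edgeContrib-point-nonneg : ∀ e → Q ≢ X → 0ℤ ≤ edgeContrib (point X -1ℤ) Q e
edgeContrib-point-nonneg {Q = Q} {X} e Q≢X =
  subst (_≤ edgeContrib (point X -1ℤ) Q e) (point-off -1ℤ (≢-sym Q≢X)) (edgeContrib-≥ (point X -1ℤ) (point-nonpos X) Q e)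

sumContrib-point-nonneg : ∀ es → Q ≢ X → 0ℤ ≤ sumContrib (point X -1ℤ) Q es
sumContrib-point-nonneg []       Q≢X = ℤP.≤-refl
sumContrib-point-nonneg (e ∷ es) Q≢X =
  ℤP.+-mono-≤ (edgeContrib-point-nonneg e Q≢X) (sumContrib-point-nonneg es Q≢X)

sumContrib-point-self : ∀ (X : Fin k) es → + length es * -1ℤ ≤ sumContrib (point X -1ℤ) X es
sumContrib-point-self X es =
  subst (λ z → + length es * z ≤ sumContrib (point X -1ℤ) X es) (point-here X -1ℤ) (sumContrib-≥ (point X -1ℤ) (point-nonpos X) X es)

sumContrib-point-joined : ∀ es → Q ≢ X → Any (Joins Q X) es → 1ℤ ≤ sumContrib (point X -1ℤ) Q es
sumContrib-point-joined (e ∷ es) Q≢X (here joins) =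
  subst (λ z → 1ℤ ≤ z + _) (sym (edgeContrib-joining e Q≢X joins))
    (ℤP.+-monoʳ-≤ 1ℤ (sumContrib-point-nonneg es Q≢X))
sumContrib-point-joined (e ∷ es) Q≢X (there joined) =
  ℤP.+-mono-≤ (edgeContrib-point-nonneg e Q≢X) (sumContrib-point-joined es Q≢X joined)

sumContrib-point-unjoined : ∀ es → Q ≢ X → All (λ e → ¬ Joins Q X e) es → sumContrib (point X -1ℤ) Q es ≡ 0ℤ
sumContrib-point-unjoined []       Q≢X []                = refl
sumContrib-point-unjoined (e ∷ es) Q≢X (¬joins ∷ ¬joined) =
  cong₂ _+_ (edgeContrib-notJoining e Q≢X ¬joins) (sumContrib-point-unjoined es Q≢X ¬joined)

joins-sameEdge : ∀ {e e'} → Joins Q X e → Joins Q X e' → SameEdge e e'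
joins-sameEdge (inj₁ (refl , refl)) (inj₁ (refl , refl)) = inj₁ (refl , refl)
joins-sameEdge (inj₁ (refl , refl)) (inj₂ (refl , refl)) = inj₂ (refl , refl)
joins-sameEdge (inj₂ (refl , refl)) (inj₁ (refl , refl)) = inj₂ (refl , refl)
joins-sameEdge (inj₂ (refl , refl)) (inj₂ (refl , refl)) = inj₁ (refl , refl)

sumContrib-point-joinedOnce : ∀ es → Q ≢ X → AllPairs (λ e e' → ¬ SameEdge e e') es →
  Any (Joins Q X) es → sumContrib (point X -1ℤ) Q es ≡ 1ℤ
sumContrib-point-joinedOnce (e ∷ es) Q≢X (distinct ∷ _) (here joins) =
  cong₂ _+_ (edgeContrib-joining e Q≢X joins)
    (sumContrib-point-unjoined es Q≢X (All.map (λ ¬same joins′ → ¬same (joins-sameEdge joins joins′)) distinct))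
sumContrib-point-joinedOnce (e ∷ es) Q≢X (distinct ∷ pairwise) (there joined) =
  cong₂ _+_ (edgeContrib-notJoining e Q≢X ¬joins) (sumContrib-point-joinedOnce es Q≢X pairwise joined)
  where
  ¬joins : ¬ Joins _ _ e
  ¬joins joins with All.lookupAny distinct joined
  ... | ¬same , joins′ = ¬same (joins-sameEdge joins joins′)

adjacent⇒joins : ∀ {R} → Adjacent es X R → Any (Joins X R) es
adjacent⇒joins (inj₁ X—R) = Any.map (λ { refl → inj₁ (refl , refl) }) X—R
adjacent⇒joins (inj₂ R—X) = Any.map (λ { refl → inj₂ (refl , refl) }) R—X

-- Submonoids of ℕ containing two consecutive numbers

module _ {S : ℕ → Set} (S-submonoid : IsSubmonoid S) where

  private
    S-0 : S 0
    S-0 = proj₁ S-submonoid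
    S-+ : ∀ a b → S a → S b → S (a ℕ.+ b)
    S-+ = proj₂ S-submonoid

  multiple : ∀ c {x} → S x → S (c ℕ.* x)
  multiple zero    Sx = S-0
  multiple (suc c) Sx = S-+ _ _ Sx (multiple c Sx)

  -- Each m ≥ a² is (q − r)·a + r·(a + 1) for m = q·a + r, as r < a ≤ q.
  consecutive⇒cofinite : ∀ {a} → S a → S (suc a) → ∃ λ N → ∀ m → N ℕ.≤ m → S m
  consecutive⇒cofinite {zero} _ S1 = 0 , λ m _ → subst S (ℕP.*-identityʳ m) (multiple m S1)
  consecutive⇒cofinite {a@(suc _)} Sa Sa+1 = a ℕ.* a , λ m a²≤m →
    subst S (decomposition m a²≤m) (S-+ _ _ (multiple (m / a ℕ.∸ m % a) Sa) (multiple (m % a) Sa+1))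
    where
    remainder≤quotient : ∀ m → a ℕ.* a ℕ.≤ m → m % a ℕ.≤ m / a
    remainder≤quotient m a²≤m = ℕP.≤-trans (ℕP.<⇒≤ (m%n<n m a))
      (subst (ℕ._≤ m / a) (m*n/n≡m a a) (/-monoˡ-≤ a a²≤m))
    regroup : ∀ x r b → x ℕ.* b ℕ.+ r ℕ.* suc b ≡ r ℕ.+ (x ℕ.+ r) ℕ.* b
    regroup = ℕ-Solver.solve-∀
    decomposition : ∀ m → a ℕ.* a ℕ.≤ m → (m / a ℕ.∸ m % a) ℕ.* a ℕ.+ m % a ℕ.* suc a ≡ m
    decomposition m a²≤m = begin
      (m / a ℕ.∸ m % a) ℕ.* a ℕ.+ m % a ℕ.* suc a ≡⟨ regroup (m / a ℕ.∸ m % a) (m % a) a ⟩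
      m % a ℕ.+ (m / a ℕ.∸ m % a ℕ.+ m % a) ℕ.* a ≡⟨ cong (λ q → m % a ℕ.+ q ℕ.* a) (ℕP.m∸n+n≡m (remainder≤quotient m a²≤m)) ⟩
      m % a ℕ.+ m / a ℕ.* a                      ≡⟨ m≡m%n+[m/n]*n m a ⟨
      m                                           ∎
      where open ≡-Reasoning

-- Admissible functions on a graph

another-element : ∀ {m} → 2 ℕ.≤ m → (P : Fin m) → ∃ λ W → W ≢ P
another-element (s≤s (s≤s _)) P = punchIn P zero , punchInᵢ≢i P zero

first-step : ∀ {A : Set} {_~_ : A → A → Set} {x y} → Star _~_ x y → y ≢ x → ∃ λ z → x ~ z
first-step ε         y≢x = contradiction refl y≢x
first-step (x~z ◅ _) _   = _ , x~z

module _ (G : Graph) (P : Fin (n G)) where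

  private
    E : ℕ
    E = length (edges G)

  Admissible : M G → Set
  Admissible g = ∀ Q → Q ≢ P → 0ℤ ≤ Δ G g Q

  PositiveAt : Fin (n G) → M G → Set
  PositiveAt X g = X ≢ P → 1ℤ ≤ Δ G g X

  admissible-0 : Admissible (λ _ → 0ℤ)
  admissible-0 Q _ = ℤP.≤-reflexive (sym (sumContrib-0 Q (edges G)))

  admissible-⊕ : ∀ {f g} → Admissible f → Admissible g → Admissible (f ⊕ g)
  admissible-⊕ {f} {g} f-adm g-adm Q Q≢P =
    subst (0ℤ ≤_) (sym (sumContrib-⊕ f g Q (edges G))) (ℤP.+-mono-≤ (f-adm Q Q≢P) (g-adm Q Q≢P))

  admissible-⊙ : ∀ m {g} → Admissible g → Admissible (+ m ⊙ g)
  admissible-⊙ m {g} g-adm Q Q≢P =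
    subst (0ℤ ≤_) (sym (sumContrib-⊙ (+ m) g Q (edges G))) (*-nonNeg m (g-adm Q Q≢P))

  Δ-nonpos : ∀ {g} → Admissible g → Δ G g P ≤ 0ℤ
  Δ-nonpos {g} g-adm =
    subst (Δ G g P ≤_) (∑-sumContrib g (edges G) (noLoops G)) (∑-≥-term P (Δ G g) g-adm)

  spread : Fin (n G) → M G → M G
  spread X g = + E ⊙ g ⊕ point X -1ℤ

  Δ-spread : ∀ X g Q → Δ G (spread X g) Q ≡ + E * Δ G g Q + sumContrib (point X -1ℤ) Q (edges G)
  Δ-spread X g Q = trans (sumContrib-⊕ (+ E ⊙ g) (point X -1ℤ) Q (edges G))
    (cong (λ z → z + sumContrib (point X -1ℤ) Q (edges G)) (sumContrib-⊙ (+ E) g Q (edges G)))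

  -- At X itself the loss of −(X) is at most E, which E·Δg(X) ≥ E absorbs.
  spread-admissible : ∀ X {g} → Admissible g → PositiveAt X g → Admissible (spread X g)
  spread-admissible X {g} g-adm g-pos Q Q≢P = subst (0ℤ ≤_) (sym (Δ-spread X g Q)) (bound (Q ≟ X))
    where
    bound : Dec (Q ≡ X) → 0ℤ ≤ + E * Δ G g Q + sumContrib (point X -1ℤ) Q (edges G)
    bound (yes refl) = begin
      0ℤ                                           ≡⟨ ℤP.*-zeroʳ (+ E) ⟨
      + E * (1ℤ + -1ℤ)                             ≡⟨ ℤP.*-distribˡ-+ (+ E) 1ℤ -1ℤ ⟩
      + E * 1ℤ + + E * -1ℤ                         ≤⟨ ℤP.+-mono-≤ (ℤP.*-monoˡ-≤-nonNeg (+ E) (g-pos Q≢P))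
                                                                  (sumContrib-point-self Q (edges G)) ⟩
      + E * Δ G g Q + sumContrib (point Q -1ℤ) Q (edges G) ∎
      where open ℤP.≤-Reasoning
    bound (no Q≢X) = ℤP.+-mono-≤ (*-nonNeg E (g-adm Q Q≢P)) (sumContrib-point-nonneg (edges G) Q≢X)

  adjacent-≢ : ∀ {X R} → Adjacent (edges G) X R → R ≢ X
  adjacent-≢ (inj₁ X—R) R≡X = All.lookup (noLoops G) X—R (sym R≡X)
  adjacent-≢ (inj₂ R—X) R≡X = All.lookup (noLoops G) R—X R≡X

  spread-positive : ∀ {X R g} → Admissible g → Adjacent (edges G) X R → PositiveAt R (spread X g)
  spread-positive {X} {R} {g} g-adm X—R R≢P = subst (1ℤ ≤_) (sym (Δ-spread X g R))
    (ℤP.+-mono-≤ (*-nonNeg E (g-adm R R≢P))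
      (sumContrib-point-joined (edges G) (adjacent-≢ X—R) (adjacent⇒joins (swap X—R))))

  PositiveWitness : Fin (n G) → Set
  PositiveWitness X = Σ (M G) λ g → Admissible g × PositiveAt X g

  positiveWitness : ∀ R → PositiveWitness R
  positiveWitness R = along (connected G P R) ((λ _ → 0ℤ) , admissible-0 , λ P≢P → contradiction refl P≢P)
    where
    along : ∀ {X R} → Star (Adjacent (edges G)) X R → PositiveWitness X → PositiveWitness R
    along ε             w                 = w
    along {X} (X—Y ◅ path) (g , g-adm , g-pos) =
      along path (spread X g , spread-admissible X g-adm g-pos , spread-positive g-adm X—Y)

  positiveEverywhere : Σ (M G) λ Φ → Admissible Φ × (∀ Q → PositiveAt Q Φ)
  positiveEverywhere = Φ , Φ-adm , Φ-pos
    where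
    witness : Fin (n G) → M G
    witness R = proj₁ (positiveWitness R)
    witness-adm : ∀ R → Admissible (witness R)
    witness-adm R = proj₁ (proj₂ (positiveWitness R))
    Φ : M G
    Φ Y = sum (λ R → witness R Y)
    Φ-adm : Admissible Φ
    Φ-adm Q Q≢P = subst (0ℤ ≤_) (sym (sumContrib-∑ witness Q (edges G)))
      (∑-nonneg _ (λ R → witness-adm R Q Q≢P))
    Φ-pos : ∀ Q → PositiveAt Q Φ
    Φ-pos Q Q≢P = subst (1ℤ ≤_) (sym (sumContrib-∑ witness Q (edges G)))
      (ℤP.≤-trans (proj₂ (proj₂ (positiveWitness Q)) Q≢P)
        (∑-≥-term Q (λ R → Δ G (witness R) Q) (λ R _ → witness-adm R Q Q≢P)))

  InH-0 : InH G P 0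
  InH-0 = (λ _ → 0ℤ) , sumContrib-0 P (edges G) , admissible-0

  InH-+ : ∀ a b → InH G P a → InH G P b → InH G P (a ℕ.+ b)
  InH-+ a b (f , Δf≡-a , f-adm) (g , Δg≡-b , g-adm) = f ⊕ g , Δ≡ , admissible-⊕ f-adm g-adm
    where
    open ≡-Reasoning
    Δ≡ : Δ G (f ⊕ g) P ≡ - (+ (a ℕ.+ b))
    Δ≡ = begin
      Δ G (f ⊕ g) P       ≡⟨ sumContrib-⊕ f g P (edges G) ⟩
      Δ G f P + Δ G g P   ≡⟨ cong₂ _+_ Δf≡-a Δg≡-b ⟩
      - (+ a) + - (+ b)   ≡⟨ ℤP.neg-distrib-+ (+ a) (+ b) ⟨
      - (+ a + + b)       ≡⟨ cong -_ (ℤP.pos-+ a b) ⟨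
      - (+ (a ℕ.+ b))     ∎

  admissible-step⇒consecutive : ∀ {f h} → Admissible f → Admissible h → Δ G h P ≡ Δ G f P + 1ℤ →
    ∃ λ a → InH G P a × InH G P (suc a)
  admissible-step⇒consecutive {f} {h} f-adm h-adm Δh≡Δf+1 with nonPos⇒neg _ (Δ-nonpos h-adm)
  ... | a , Δh≡-a = a , (h , Δh≡-a , h-adm) , (f , Δf≡-suc-a , f-adm)
    where
    open ≡-Reasoning
    Δf≡-suc-a : Δ G f P ≡ - (+ suc a)
    Δf≡-suc-a = begin
      Δ G f P                   ≡⟨ ℤP.+-identityʳ (Δ G f P) ⟨
      Δ G f P + (1ℤ + -1ℤ)      ≡⟨ ℤP.+-assoc (Δ G f P) 1ℤ -1ℤ ⟨
      (Δ G f P + 1ℤ) - 1ℤ       ≡⟨ cong (λ z → z - 1ℤ) (trans (sym Δh≡Δf+1) Δh≡-a) ⟩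
      - (+ a) - 1ℤ              ≡⟨ neg-minus-one a ⟩
      - (+ suc a)               ∎

  consecutive : IsSimple G → ∃ λ a → InH G P a × InH G P (suc a)
  consecutive (distinct , 2≤n) with positiveEverywhere | another-element 2≤n P
  ... | Φ , Φ-adm , Φ-pos | W , W≢P with first-step (connected G P W) W≢P
  ... | Y , P—Y =
    admissible-step⇒consecutive (admissible-⊙ E Φ-adm) (spread-admissible Y Φ-adm (Φ-pos Y))
      (trans (sumContrib-⊕ (+ E ⊙ Φ) (point Y -1ℤ) P (edges G)) (cong (λ z → Δ G (+ E ⊙ Φ) P + z)
        (sumContrib-point-joinedOnce (edges G) (≢-sym (adjacent-≢ P—Y)) distinct (adjacent⇒joins P—Y))))

lemma4p1 : (G : Graph) (P : Fin (n G)) →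
    IsSubmonoid (InH G P) × (IsSimple G → IsNumericalSemigroup (InH G P))
lemma4p1 G P = submonoid , λ simple → submonoid , cofinite (consecutive G P simple)
  where
  submonoid : IsSubmonoid (InH G P)
  submonoid = InH-0 G P , InH-+ G P
  cofinite : (∃ λ a → InH G P a × InH G P (suc a)) → ∃ λ N → ∀ m → N ℕ.≤ m → InH G P m
  cofinite (a , Sa , Sa+1) = consecutive⇒cofinite submonoid Sa Sa+1
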